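{- Let $G=(V,E,w)$ be a finite vertex-weighted graph with nonnegative vertex weights and maximum degree $\Delta$. For any $\varepsilon\in(0,0.1]$ and integer $k\in\mathbb{Z}_+$, if $k\ge\max\left\{\frac{\chi(G)}{\varepsilon},2\Delta\right\}$ and $\max_{v\in V}w_v\le \varepsilon\frac{w(V)}{k}$, then there exists a $(1+7\varepsilon)$-EQ1 $k$-coloring of $G$, where $\chi(G)$ denotes the chromatic number of $G$.
   Context: For $S\subseteq V$, $w(S)=\sum_{v\in S}w_v$. A $k$-coloring of $G$ is a partition $(C_1,\dots,C_k)$ of $V$ into $k$ (possibly empty) sets, each of which is an independent set of $G$. For $\alpha\ge 1$, a coloring $(C_1,\dots,C_k)$ is $\alpha$-EQ1 if for every $i,j\in[k]$ with $C_i\neq\emptyset$ there exists a vertex $\bar v\in C_i$ such that $w(C_i\setminus\{\bar v\})\le \alpha\, w(C_j)$.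
   Formalization: The parameter ε ranges only over the rationals in $(0,0.1]$. -}

module Defs where

open import Data.Nat as ℕ using (ℕ; zero; suc; _⊔_)
open import Data.Bool using (Bool; true; false)
open import Data.Fin using (Fin; zero; suc; _≟_)
open import Data.Fin.Subset using (Subset; inside; outside; _∈_; _-_; Nonempty; ∣_∣; ⊤)
open import Data.Vec using (Vec; []; _∷_; tabulate)
open import Data.List using (List; foldr; map; allFin)
open import Data.Product using (Σ; ∃; _×_; _,_)
open import Relation.Nullary.Decidable using (⌊_⌋)
open import Relation.Binary.PropositionalEquality using (_≡_; _≢_)
open import Data.Rational using (ℚ; 0ℚ; _+_; _*_; _≤_)

record Graph (n : ℕ) : Set where
  field
    adj     : Fin n → Fin n → Bool
    symm    : ∀ u v → adj u v ≡ adj v u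
    irrefl  : ∀ v → adj v v ≡ false
open Graph public

nbhd : ∀ {n} → Graph n → Fin n → Subset n
nbhd G v = tabulate (adj G v)

degree : ∀ {n} → Graph n → Fin n → ℕ
degree G v = ∣ nbhd G v ∣

maxDegree : ∀ {n} → Graph n → ℕ
maxDegree {n} G = foldr _⊔_ 0 (map (degree G) (allFin n))

IsProperColoring : ∀ {n} → Graph n → (k : ℕ) → (Fin n → Fin k) → Set
IsProperColoring G k c = ∀ u v → adj G u v ≡ true → c u ≢ c v

Colorable : ∀ {n} → Graph n → ℕ → Set
Colorable {n} G k = Σ (Fin n → Fin k) (IsProperColoring G k)

IsChromaticNumber : ∀ {n} → Graph n → ℕ → Set
IsChromaticNumber G χ = Colorable G χ × (∀ k → Colorable G k → χ ℕ.≤ k)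

colorClass : ∀ {n k} → (Fin n → Fin k) → Fin k → Subset n
colorClass c i = tabulate (λ v → ⌊ c v ≟ i ⌋)

wt : ∀ {n} → (Fin n → ℚ) → Subset n → ℚ
wt w [] = 0ℚ
wt w (inside ∷ S) = w zero + wt (λ v → w (suc v)) S
wt w (outside ∷ S) = wt (λ v → w (suc v)) S

IsEQ1 : ∀ {n k} → (Fin n → ℚ) → ℚ → (Fin n → Fin k) → Set
IsEQ1 w α c = ∀ i j → Nonempty (colorClass c i) →
  ∃ λ v̄ → v̄ ∈ colorClass c i × wt w (colorClass c i - v̄) ≤ α * wt w (colorClass c j)

-- Let a = w(V)/k be the average class weight, L = (1 - 2ε)a, U = (1 + 3ε)a and μ = εa,
-- which bounds every vertex weight.  First, taking the classes of an optimal χ-colouring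
-- one at a time, vertices are poured into bins, a bin being closed as soon as it weighs at
-- least L: closed bins are independent and weigh between L and L + μ, and the open bin left
-- over after each class, lighter than L, is discarded.  As χ ≤ εk, at most (εk + 1)L weight
-- is lost, so at least k bins get closed unless a = 0.  Then the discarded vertices are
-- coloured one at a time with a lightest colour not used by a neighbour: at most Δ ≤ k/2
-- colours are blocked and all classes weigh at least L, so the chosen one weighs at most
-- L + 4εa and every class stays within [L, U].  Finally U ≤ (1 + 7ε)L, so every class is
-- within the factor 1 + 7ε of every other even before a vertex is removed.

{-# OPTIONS --safe #-}
module Submission where

open import Defs
open import Data.Nat as ℕ using (ℕ; zero; suc)
import Data.Nat.Properties as ℕ
open import Data.Nat.Coprimality using (1-coprimeTo) renaming (sym to coprime-sym)
open import Data.Integer using (+_)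
import Data.Integer as ℤ
import Data.Integer.Properties as ℤ
open import Data.Rational
  using (ℚ; mkℚ; 0ℚ; 1ℚ; _+_; _*_; _-_; -_; _≤_; _<_; _/_; _≤?_; 1/_; NonZero; Positive; nonNegative; positive)
open import Data.Rational.Properties
open import Data.Rational.Solver using (module +-*-Solver)
open import Algebra.Bundles using (Ring)
open import Algebra.Properties.Semiring.Sum (Ring.semiring +-*-ring)
  using (sum; sum-syntax; sum-cong-≗; sum-replicate-zero; ∑-distrib-+; ∑-comm; *-distribˡ-sum)
open import Data.Fin as Fin using (Fin; zero; suc; toℕ)
import Data.Fin.Properties as Fin
open import Data.Fin.Subset using (Subset; inside; outside; _─_; ⁅_⁆; ⊤; ∣_∣)
open import Data.Vec using ([]; _∷_; tabulate)
open import Data.List using (List; []; _∷_; allFin; length; foldr; map)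
open import Data.List.Properties using (length-tabulate)
open import Data.List.Membership.Propositional using (_∈_)
open import Data.List.Relation.Unary.Any using (here; there)
open import Data.List.Relation.Unary.All as All using (All; []; _∷_)
open import Data.List.Membership.Propositional.Properties using (∈-allFin)
open import Data.Vec.Functional using (updateAt)
open import Data.Vec.Functional.Properties using (updateAt-updates; updateAt-minimal)
open import Data.Bool using (Bool; true; false; if_then_else_; _∧_)
import Data.Bool.Properties as Bool
open import Data.Maybe using (Maybe; just; nothing)
open import Data.Maybe.Properties using (≡-dec; just-injective)
open import Data.Product using (Σ; ∃; _×_; _,_; proj₁; proj₂)
open import Data.Sum using (_⊎_; inj₁; inj₂)
open import Function using (_∘_; id; const; _⇔_; mk⇔; Equivalence)
open import Relation.Nullary using (¬_; yes; no; does; contradiction)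
open import Relation.Binary.PropositionalEquality
open import Relation.Binary.Definitions using (DecidableEquality)
open import Relation.Nullary.Decidable using (dec-true; dec-false; does-⇔; isYes≗does; ¬?; _×-dec_; decidable-stable)
open import Relation.Unary using (Decidable)

open +-*-Solver

fromℕ : ℕ → ℚ
fromℕ m = + m / 1

fromℕ-suc : ∀ m → fromℕ (suc m) ≡ 1ℚ + fromℕ m
fromℕ-suc m = begin
  + suc m / 1   ≡⟨ /-cong (cong (λ i → + 1 ℤ.+ i) (ℤ.*-identityʳ (+ m))) refl ⟨
  1ℚ + m/1      ≡⟨ cong (λ x → 1ℚ + x) (↥p/↧p≡p m/1) ⟨
  1ℚ + fromℕ m  ∎
  where
  open ≡-Reasoning
  m/1 = mkℚ (+ m) 0 (coprime-sym (1-coprimeTo m))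

fromℕ-+ : ∀ m n → fromℕ (m ℕ.+ n) ≡ fromℕ m + fromℕ n
fromℕ-+ zero    n = sym (+-identityˡ (fromℕ n))
fromℕ-+ (suc m) n = begin
  fromℕ (suc (m ℕ.+ n))       ≡⟨ fromℕ-suc (m ℕ.+ n) ⟩
  1ℚ + fromℕ (m ℕ.+ n)        ≡⟨ cong (λ x → 1ℚ + x) (fromℕ-+ m n) ⟩
  1ℚ + (fromℕ m + fromℕ n)    ≡⟨ +-assoc 1ℚ (fromℕ m) (fromℕ n) ⟨
  1ℚ + fromℕ m + fromℕ n      ≡⟨ cong (_+ fromℕ n) (fromℕ-suc m) ⟨
  fromℕ (suc m) + fromℕ n     ∎
  where open ≡-Reasoning

p≤p+q : ∀ {p q} → 0ℚ ≤ q → p ≤ p + q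
p≤p+q {p} {q} 0≤q = begin
  p       ≡⟨ +-identityʳ p ⟨
  p + 0ℚ  ≤⟨ +-monoʳ-≤ p 0≤q ⟩
  p + q   ∎
  where open ≤-Reasoning

p≤q+p : ∀ {p q} → 0ℚ ≤ q → p ≤ q + p
p≤q+p {p} {q} 0≤q = subst (p ≤_) (+-comm p q) (p≤p+q 0≤q)

+-nonNeg : ∀ {p q} → 0ℚ ≤ p → 0ℚ ≤ q → 0ℚ ≤ p + q
+-nonNeg 0≤p 0≤q = ≤-trans 0≤p (p≤p+q 0≤q)

*-monoˡ-≤-nonNeg′ : ∀ {r p q} → 0ℚ ≤ r → p ≤ q → r * p ≤ r * q
*-monoˡ-≤-nonNeg′ {r} 0≤r = *-monoˡ-≤-nonNeg r {{nonNegative 0≤r}}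

*-monoʳ-≤-nonNeg′ : ∀ {r p q} → 0ℚ ≤ r → p ≤ q → p * r ≤ q * r
*-monoʳ-≤-nonNeg′ {r} 0≤r = *-monoʳ-≤-nonNeg r {{nonNegative 0≤r}}

*-cancelˡ-≤-pos′ : ∀ {r p q} → 0ℚ < r → r * p ≤ r * q → p ≤ q
*-cancelˡ-≤-pos′ {r} 0<r = *-cancelˡ-≤-pos r {{positive 0<r}}

*-nonNeg : ∀ {p q} → 0ℚ ≤ p → 0ℚ ≤ q → 0ℚ ≤ p * q
*-nonNeg {p} 0≤p 0≤q = subst (_≤ p * _) (*-zeroʳ p) (*-monoˡ-≤-nonNeg′ 0≤p 0≤q)

0≤q-p⇒p≤q : ∀ {p q} → 0ℚ ≤ q - p → p ≤ q
0≤q-p⇒p≤q {p} {q} 0≤q-p = begin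
  p            ≤⟨ p≤p+q 0≤q-p ⟩
  p + (q - p)  ≡⟨ solve 2 (λ p q → p :+ (q :- p) := q) refl p q ⟩
  q            ∎
  where open ≤-Reasoning

p≤q⇒0≤q-p : ∀ {p q} → p ≤ q → 0ℚ ≤ q - p
p≤q⇒0≤q-p {p} {q} p≤q = begin
  0ℚ     ≡⟨ +-inverseʳ p ⟨
  p - p  ≤⟨ +-monoˡ-≤ (- p) p≤q ⟩
  q - p  ∎
  where open ≤-Reasoning

fromℕ-nonNeg : ∀ m → 0ℚ ≤ fromℕ m
fromℕ-nonNeg zero    = ≤-refl
fromℕ-nonNeg (suc m) = subst (0ℚ ≤_) (sym (fromℕ-suc m)) (+-nonNeg (<⇒≤ (positive⁻¹ 1ℚ)) (fromℕ-nonNeg m))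

fromℕ-mono-≤ : ∀ {m n} → m ℕ.≤ n → fromℕ m ≤ fromℕ n
fromℕ-mono-≤ {m} {n} m≤n = subst (fromℕ m ≤_)
  (trans (sym (fromℕ-+ m (n ℕ.∸ m))) (cong fromℕ (ℕ.m+[n∸m]≡n m≤n)))
  (p≤p+q (fromℕ-nonNeg (n ℕ.∸ m)))

fromℕ-cancel-≤ : ∀ {m n} → fromℕ m ≤ fromℕ n → m ℕ.≤ n
fromℕ-cancel-≤ {m} {n} m≤n with ℕ.≤-<-connex m n
... | inj₁ m≤n′ = m≤n′
... | inj₂ n<m  = contradiction (begin-strict
  fromℕ n        <⟨ p<1+p ⟩
  1ℚ + fromℕ n   ≡⟨ fromℕ-suc n ⟨
  fromℕ (suc n)  ≤⟨ fromℕ-mono-≤ n<m ⟩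
  fromℕ m        ≤⟨ m≤n ⟩
  fromℕ n        ∎) (<-irrefl refl)
  where
  open ≤-Reasoning
  p<1+p : ∀ {p} → p < 1ℚ + p
  p<1+p {p} = subst (_< 1ℚ + p) (+-identityˡ p) (+-monoˡ-< p (positive⁻¹ 1ℚ))

sum-mono : ∀ {n} {f g : Fin n → ℚ} → (∀ i → f i ≤ g i) → sum f ≤ sum g
sum-mono {zero}  f≤g = ≤-refl
sum-mono {suc n} f≤g = +-mono-≤ (f≤g zero) (sum-mono (f≤g ∘ suc))

sum-nonNeg : ∀ {n} {f : Fin n → ℚ} → (∀ i → 0ℚ ≤ f i) → 0ℚ ≤ sum f
sum-nonNeg {zero}  0≤f = ≤-refl
sum-nonNeg {suc n} 0≤f = +-nonNeg (0≤f zero) (sum-nonNeg (0≤f ∘ suc))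

sum-const : ∀ n (c : ℚ) → ∑[ i < n ] c ≡ fromℕ n * c
sum-const zero    c = sym (*-zeroˡ c)
sum-const (suc n) c = begin
  c + ∑[ i < n ] c        ≡⟨ cong (λ x → c + x) (sum-const n c) ⟩
  c + fromℕ n * c         ≡⟨ solve 2 (λ c m → c :+ m :* c := (con 1ℚ :+ m) :* c) refl c (fromℕ n) ⟩
  (1ℚ + fromℕ n) * c      ≡⟨ cong (_* c) (fromℕ-suc n) ⟨
  fromℕ (suc n) * c       ∎
  where open ≡-Reasoning

f≤sum : ∀ {n} {f : Fin n → ℚ} → (∀ i → 0ℚ ≤ f i) → ∀ i → f i ≤ sum f
f≤sum 0≤f zero    = p≤p+q (sum-nonNeg (0≤f ∘ suc))
f≤sum 0≤f (suc i) = ≤-trans (f≤sum (0≤f ∘ suc) i) (p≤q+p (0≤f zero))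

sum-increase-at : ∀ {n} (f g : Fin n → ℚ) v δ → g v ≡ f v + δ → (∀ u → u ≢ v → g u ≡ f u) →
                  sum g ≡ sum f + δ
sum-increase-at f g zero δ gv g≗f = begin
  g zero + sum (g ∘ suc)           ≡⟨ cong₂ _+_ gv (sum-cong-≗ (λ u → g≗f (suc u) λ ())) ⟩
  f zero + δ + sum (f ∘ suc)       ≡⟨ solve 3 (λ a d s → a :+ d :+ s := a :+ s :+ d) refl (f zero) δ (sum (f ∘ suc)) ⟩
  f zero + sum (f ∘ suc) + δ       ∎
  where open ≡-Reasoning
sum-increase-at f g (suc v) δ gv g≗f = begin
  g zero + sum (g ∘ suc)           ≡⟨ cong₂ _+_ (g≗f zero λ ()) (sum-increase-at (f ∘ suc) (g ∘ suc) v δ gv g≗f′) ⟩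
  f zero + (sum (f ∘ suc) + δ)     ≡⟨ +-assoc (f zero) _ δ ⟨
  f zero + sum (f ∘ suc) + δ       ∎
  where
  open ≡-Reasoning
  g≗f′ : ∀ u → u ≢ v → g (suc u) ≡ f (suc u)
  g≗f′ u u≢v = g≗f (suc u) (u≢v ∘ Fin.suc-injective)

wtWhere : ∀ {n} → (Fin n → ℚ) → (Fin n → Bool) → ℚ
wtWhere {n} w P = ∑[ v < n ] (if P v then w v else 0ℚ)

module _ {n} (w : Fin n → ℚ) where

  wtWhere-cong : ∀ {P Q : Fin n → Bool} → (∀ v → P v ≡ Q v) → wtWhere w P ≡ wtWhere w Q
  wtWhere-cong P≗Q = sum-cong-≗ (λ v → cong (λ b → if b then w v else 0ℚ) (P≗Q v))

  wtWhere-none : ∀ {P : Fin n → Bool} → (∀ v → P v ≡ false) → wtWhere w P ≡ 0ℚ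
  wtWhere-none {P} P≡false = trans (wtWhere-cong P≡false) (sum-replicate-zero n)

  wtWhere-all : ∀ {P : Fin n → Bool} → (∀ v → P v ≡ true) → wtWhere w P ≡ sum w
  wtWhere-all P≡true = sum-cong-≗ (λ v → cong (λ b → if b then w v else 0ℚ) (P≡true v))

  wtWhere-insert : ∀ {P Q : Fin n → Bool} v → P v ≡ false → Q v ≡ true →
                   (∀ u → u ≢ v → Q u ≡ P u) → wtWhere w Q ≡ wtWhere w P + w v
  wtWhere-insert {P} {Q} v Pv Qv Q≗P = sum-increase-at _ _ v (w v) atv (λ u u≢v → cong (λ b → if b then w u else 0ℚ) (Q≗P u u≢v))
    where
    atv : (if Q v then w v else 0ℚ) ≡ (if P v then w v else 0ℚ) + w v
    atv rewrite Pv | Qv = sym (+-identityˡ (w v))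

  module _ (0≤w : ∀ v → 0ℚ ≤ w v) where

    wtWhere-nonNeg : ∀ P → 0ℚ ≤ wtWhere w P
    wtWhere-nonNeg P = sum-nonNeg (λ v → if-nonNeg (P v) v)
      where
      if-nonNeg : ∀ b v → 0ℚ ≤ (if b then w v else 0ℚ)
      if-nonNeg true  v = 0≤w v
      if-nonNeg false v = ≤-refl

wt-─ : ∀ {n} (w : Fin n → ℚ) → (∀ v → 0ℚ ≤ w v) → (p q : Subset n) → wt w (p ─ q) ≤ wt w p
wt-─ w 0≤w []            []            = ≤-refl
wt-─ w 0≤w (inside  ∷ p) (inside  ∷ q) = ≤-trans (wt-─ (w ∘ suc) (0≤w ∘ suc) p q) (p≤q+p (0≤w zero))
wt-─ w 0≤w (inside  ∷ p) (outside ∷ q) = +-monoʳ-≤ (w zero) (wt-─ (w ∘ suc) (0≤w ∘ suc) p q)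
wt-─ w 0≤w (outside ∷ p) (inside  ∷ q) = wt-─ (w ∘ suc) (0≤w ∘ suc) p q
wt-─ w 0≤w (outside ∷ p) (outside ∷ q) = wt-─ (w ∘ suc) (0≤w ∘ suc) p q

wt-tabulate : ∀ {n} (w : Fin n → ℚ) (P : Fin n → Bool) → wt w (tabulate P) ≡ wtWhere w P
wt-tabulate {zero}  w P = refl
wt-tabulate {suc n} w P with P zero
... | true  = cong (λ x → w zero + x) (wt-tabulate (w ∘ suc) (P ∘ suc))
... | false = trans (wt-tabulate (w ∘ suc) (P ∘ suc)) (sym (+-identityˡ _))

wt-⊤ : ∀ {n} (w : Fin n → ℚ) → wt w ⊤ ≡ sum w
wt-⊤ {zero}  w = refl
wt-⊤ {suc n} w = cong (λ x → w zero + x) (wt-⊤ (w ∘ suc))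

_[_≔_] : ∀ {n} {A : Set} → (Fin n → A) → Fin n → A → Fin n → A
ℓ [ v ≔ a ] = updateAt ℓ v (const a)

relabel-at : ∀ {n} {A : Set} (ℓ : Fin n → A) v a → (ℓ [ v ≔ a ]) v ≡ a
relabel-at ℓ v a = updateAt-updates v ℓ

relabel-elsewhere : ∀ {n} {A : Set} (ℓ : Fin n → A) {v} a {u} → u ≢ v → (ℓ [ v ≔ a ]) u ≡ ℓ u
relabel-elsewhere ℓ {v} a {u} u≢v = updateAt-minimal u v ℓ u≢v

relabel-agree : ∀ {n} {A : Set} (ℓ : Fin n → A) {v} a {u b} → u ≢ v →
                (ℓ [ v ≔ a ]) u ≡ b → (ℓ [ v ≔ a ]) v ≡ b → ℓ u ≡ a
relabel-agree ℓ {v} a u≢v eu ev =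
  trans (sym (relabel-elsewhere ℓ a u≢v)) (trans eu (trans (sym ev) (relabel-at ℓ v a)))

module Load {A : Set} (_≟ᴬ_ : DecidableEquality A) {n} (w : Fin n → ℚ) where

  load : (Fin n → A) → A → ℚ
  load ℓ a = wtWhere w (λ v → does (ℓ v ≟ᴬ a))

  load-absent : ∀ ℓ a → (∀ v → ℓ v ≢ a) → load ℓ a ≡ 0ℚ
  load-absent ℓ a ℓ≢a = wtWhere-none w (λ v → dec-false (ℓ v ≟ᴬ a) (ℓ≢a v))

  load-relabel-to : ∀ ℓ v {a} → ℓ v ≢ a → load (ℓ [ v ≔ a ]) a ≡ load ℓ a + w v
  load-relabel-to ℓ v {a} ℓv≢a = wtWhere-insert w v
    (dec-false (ℓ v ≟ᴬ a) ℓv≢a)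
    (dec-true (_ ≟ᴬ a) (relabel-at ℓ v a))
    (λ u u≢v → cong (λ x → does (x ≟ᴬ a)) (relabel-elsewhere ℓ a u≢v))

  load-relabel-other : ∀ ℓ v {a b} → ℓ v ≢ b → a ≢ b → load (ℓ [ v ≔ a ]) b ≡ load ℓ b
  load-relabel-other ℓ v {a} {b} ℓv≢b a≢b = wtWhere-cong w pointwise
    where
    pointwise : ∀ u → does ((ℓ [ v ≔ a ]) u ≟ᴬ b) ≡ does (ℓ u ≟ᴬ b)
    pointwise u with u Fin.≟ v
    ... | yes refl = trans (dec-false (_ ≟ᴬ b) (a≢b ∘ trans (sym (relabel-at ℓ u a))))
                           (sym (dec-false (ℓ u ≟ᴬ b) ℓv≢b))
    ... | no u≢v   = cong (λ x → does (x ≟ᴬ b)) (relabel-elsewhere ℓ a u≢v)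

  load-relabel-from : ∀ ℓ v {a b} → ℓ v ≡ a → b ≢ a → load ℓ a ≡ load (ℓ [ v ≔ b ]) a + w v
  load-relabel-from ℓ v {a} {b} ℓv≡a b≢a = wtWhere-insert w v
    (dec-false (_ ≟ᴬ a) (b≢a ∘ trans (sym (relabel-at ℓ v b))))
    (dec-true (ℓ v ≟ᴬ a) ℓv≡a)
    (λ u u≢v → cong (λ x → does (x ≟ᴬ a)) (sym (relabel-elsewhere ℓ b u≢v)))

  module _ (0≤w : ∀ v → 0ℚ ≤ w v) where

    load-nonNeg : ∀ ℓ a → 0ℚ ≤ load ℓ a
    load-nonNeg ℓ a = wtWhere-nonNeg w 0≤w _

indicator : Bool → ℚ
indicator b = if b then 1ℚ else 0ℚ

indicator-nonNeg : ∀ b → 0ℚ ≤ indicator b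
indicator-nonNeg true  = <⇒≤ (positive⁻¹ 1ℚ)
indicator-nonNeg false = ≤-refl

fromℕ-∣tabulate∣ : ∀ {n} (P : Fin n → Bool) → fromℕ ∣ tabulate P ∣ ≡ ∑[ v < n ] indicator (P v)
fromℕ-∣tabulate∣ {zero}  P = refl
fromℕ-∣tabulate∣ {suc n} P with P zero
... | true  = trans (fromℕ-suc ∣ tabulate (P ∘ suc) ∣) (cong (λ x → 1ℚ + x) (fromℕ-∣tabulate∣ (P ∘ suc)))
... | false = trans (fromℕ-∣tabulate∣ (P ∘ suc)) (sym (+-identityˡ _))

argmin? : ∀ {m} {P : Fin m → Set} → Decidable P → (f : Fin m → ℚ) →
          (∀ j → ¬ P j) ⊎ ∃ λ j → P j × (∀ j′ → P j′ → f j ≤ f j′)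
argmin? {zero}  P? f = inj₁ λ ()
argmin? {suc m} P? f with argmin? (P? ∘ suc) (f ∘ suc) | P? zero
... | inj₁ none | no ¬p₀ = inj₁ λ { zero → ¬p₀ ; (suc j) → none j }
... | inj₁ none | yes p₀ = inj₂ (zero , p₀ , λ { zero _ → ≤-refl ; (suc j) pj → contradiction pj (none j) })
... | inj₂ (j , pj , min) | no ¬p₀ =
  inj₂ (suc j , pj , λ { zero p₀ → contradiction p₀ ¬p₀ ; (suc j′) pj′ → min j′ pj′ })
... | inj₂ (j , pj , min) | yes p₀ with f zero ≤? f (suc j)
...   | yes f₀≤ = inj₂ (zero , p₀ , λ { zero _ → ≤-refl ; (suc j′) pj′ → ≤-trans f₀≤ (min j′ pj′) })
...   | no  f₀≰ = inj₂ (suc j , pj , λ { zero _ → <⇒≤ (≰⇒> f₀≰) ; (suc j′) pj′ → min j′ pj′ })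

-- The encoding as Maybe (Maybe ℕ) only serves to inherit decidable equality.
Slot : Set
Slot = Maybe (Maybe ℕ)

pattern unseen    = nothing
pattern discarded = just nothing
pattern bin j     = just (just j)

_≟ˢ_ : DecidableEquality Slot
_≟ˢ_ = ≡-dec (≡-dec ℕ._≟_)

bin-injective : ∀ {i j : ℕ} → bin i ≡ bin j → i ≡ j
bin-injective = just-injective ∘ just-injective

discardBin : ℕ → Slot → Slot
discardBin b s with s ≟ˢ bin b
... | yes _ = discarded
... | no  _ = s

discardBin-reflects : ∀ b s {t} → t ≢ discarded → discardBin b s ≡ t → s ≡ t
discardBin-reflects b s t≢discarded e with s ≟ˢ bin b
... | yes _ = contradiction (sym e) t≢discarded
... | no  _ = e

discardBin-preserves : ∀ b s {t} → t ≢ bin b → s ≡ t → discardBin b s ≡ t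
discardBin-preserves b s t≢bin e with s ≟ˢ bin b
... | yes s≡bin = contradiction (trans (sym e) s≡bin) t≢bin
... | no  _     = e

discardBin-removes : ∀ b s → discardBin b s ≢ bin b
discardBin-removes b s e with s ≟ˢ bin b
... | yes _     = contradiction e λ ()
... | no  s≢bin = s≢bin e

module PartialColourings {n} (G : Graph n) (w : Fin n → ℚ) (0≤w : ∀ v → 0ℚ ≤ w v) (k : ℕ) where

  _≟ᶜ_ : DecidableEquality (Maybe (Fin k))
  _≟ᶜ_ = ≡-dec Fin._≟_

  open Load _≟ᶜ_ w using () renaming (load to loadᶜ; load-relabel-to to loadᶜ-relabel-to;
    load-relabel-other to loadᶜ-relabel-other)

  PartialColouring : Set
  PartialColouring = Fin n → Maybe (Fin k)

  classWeight : PartialColouring → Fin k → ℚ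
  classWeight p j = loadᶜ p (just j)

  IsProperPartial : PartialColouring → Set
  IsProperPartial p = ∀ u v {j} → adj G u v ≡ true → p u ≡ just j → p v ≢ just j

  record Balanced (lo hi : ℚ) (p : PartialColouring) : Set where
    field
      proper : IsProperPartial p
      lower  : ∀ j → lo ≤ classWeight p j
      upper  : ∀ j → classWeight p j ≤ hi

  ∑-one-class≤ : ∀ (x : Maybe (Fin k)) {c} → 0ℚ ≤ c → ∑[ j < k ] (if does (x ≟ᶜ just j) then c else 0ℚ) ≤ c
  ∑-one-class≤ nothing  0≤c = subst (_≤ _) (sym (sum-replicate-zero k)) 0≤c
  ∑-one-class≤ (just i) {c} 0≤c = ≤-reflexive (begin
    ∑[ j < k ] (if does (just i ≟ᶜ just j) then c else 0ℚ)  ≡⟨ sum-increase-at (const 0ℚ) _ i c at-i elsewhere ⟩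
    ∑[ j < k ] 0ℚ + c                                        ≡⟨ cong (_+ c) (sum-replicate-zero k) ⟩
    0ℚ + c                                                   ≡⟨ +-identityˡ c ⟩
    c                                                        ∎)
    where
    open ≡-Reasoning
    at-i : (if does (just i ≟ᶜ just i) then c else 0ℚ) ≡ 0ℚ + c
    at-i rewrite dec-true (i Fin.≟ i) refl = sym (+-identityˡ c)
    elsewhere : ∀ j → j ≢ i → (if does (just i ≟ᶜ just j) then c else 0ℚ) ≡ 0ℚ
    elsewhere j j≢i rewrite dec-false (i Fin.≟ j) (j≢i ∘ sym) = refl

  ∑-classWeight≤total : ∀ p → ∑[ j < k ] classWeight p j ≤ sum w
  ∑-classWeight≤total p = begin
    ∑[ j < k ] ∑[ v < n ] term j v   ≡⟨ ∑-comm term ⟩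
    ∑[ v < n ] ∑[ j < k ] term j v   ≤⟨ sum-mono (λ v → ∑-one-class≤ (p v) (0≤w v)) ⟩
    sum w                            ∎
    where
    open ≤-Reasoning
    term : Fin k → Fin n → ℚ
    term j v = if does (p v ≟ᶜ just j) then w v else 0ℚ

  proper-total : ∀ {c} → IsProperPartial (just ∘ c) → IsProperColoring G k c
  proper-total proper u v a cu≡cv = proper u v a refl (cong just (sym cu≡cv))

  wt-colorClass : ∀ c j → wt w (colorClass c j) ≡ classWeight (just ∘ c) j
  wt-colorClass c j = trans (wt-tabulate w _) (wtWhere-cong w λ v → isYes≗does (c v Fin.≟ j))

  Balanced⇒IsEQ1 : ∀ {c lo hi α} → Balanced lo hi (just ∘ c) → 0ℚ ≤ α → hi ≤ α * lo → IsEQ1 w α c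
  Balanced⇒IsEQ1 {c} {lo} {hi} {α} bal 0≤α hi≤α*lo i j (v̄ , v̄∈) = v̄ , v̄∈ , (begin
    wt w (colorClass c i ─ ⁅ v̄ ⁆)    ≤⟨ wt-─ w 0≤w (colorClass c i) _ ⟩
    wt w (colorClass c i)            ≡⟨ wt-colorClass c i ⟩
    classWeight (just ∘ c) i         ≤⟨ upper i ⟩
    hi                               ≤⟨ hi≤α*lo ⟩
    α * lo                           ≤⟨ *-monoˡ-≤-nonNeg′ 0≤α (lower j) ⟩
    α * classWeight (just ∘ c) j     ≡⟨ cong (α *_) (wt-colorClass c j) ⟨
    α * wt w (colorClass c j)        ∎)
    where
    open ≤-Reasoning
    open Balanced bal

  Balanced-weaken : ∀ {lo hi hi′ p} → hi ≤ hi′ → Balanced lo hi p → Balanced lo hi′ p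
  Balanced-weaken hi≤hi′ bal = record
    { proper = proper ; lower = lower ; upper = λ j → ≤-trans (upper j) hi≤hi′ }
    where open Balanced bal

  Balanced-cong : ∀ {lo hi p q} → (∀ v → p v ≡ q v) → Balanced lo hi p → Balanced lo hi q
  Balanced-cong {lo} {hi} {p} {q} p≗q bal = record
    { proper = λ u v a e₁ e₂ → proper u v a (trans (p≗q u) e₁) (trans (p≗q v) e₂)
    ; lower  = λ j → subst (lo ≤_) (same-weight j) (lower j)
    ; upper  = λ j → subst (_≤ hi) (same-weight j) (upper j)
    }
    where
    open Balanced bal
    same-weight : ∀ j → classWeight p j ≡ classWeight q j
    same-weight j = wtWhere-cong w (λ v → cong (λ x → does (x ≟ᶜ just j)) (p≗q v))

  toColour : Slot → Maybe (Fin k)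
  toColour (bin j) with j ℕ.<? k
  ... | yes j<k = just (Fin.fromℕ< j<k)
  ... | no  _   = nothing
  toColour unseen    = nothing
  toColour discarded = nothing

  toColour-≡ : ∀ s i → toColour s ≡ just i ⇔ s ≡ bin (toℕ i)
  toColour-≡ s i = mk⇔ (to s) from
    where
    to : ∀ s → toColour s ≡ just i → s ≡ bin (toℕ i)
    to (bin j) e with j ℕ.<? k
    ... | yes j<k = cong bin (trans (sym (Fin.toℕ-fromℕ< j<k)) (cong toℕ (just-injective e)))
    to (bin j) () | no _
    to unseen    ()
    to discarded ()
    from : s ≡ bin (toℕ i) → toColour s ≡ just i
    from refl with toℕ i ℕ.<? k
    ... | yes i<k = cong just (Fin.fromℕ<-toℕ i i<k)
    ... | no  i≮k = contradiction (Fin.toℕ<n i) i≮k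

  module BinPacking {χ} (d : Fin n → Fin χ) (d-proper : IsProperColoring G χ d)
    (L μ : ℚ) (0≤L : 0ℚ ≤ L) (0≤μ : 0ℚ ≤ μ) (w≤μ : ∀ v → w v ≤ μ)
    (few-bins⇒L≤0 : ∀ b → b ℕ.< k → sum w ≤ fromℕ b * (L + μ) + (fromℕ χ + 1ℚ) * L → L ≤ 0ℚ) where

    open Load _≟ˢ_ w renaming (load to loadˢ)

    -- Unseen weight, b closed bins of weight at most L + μ, the current bin,
    -- and m discarded partial bins of weight at most L each.
    budget : ℚ → ℕ → ℚ → ℕ → ℚ
    budget unseenW b currentW m = unseenW + fromℕ b * (L + μ) + currentW + fromℕ m * L

    budget-discard : ∀ X b {Y} m → Y ≤ L → budget X b Y m ≤ budget X b 0ℚ (suc m)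
    budget-discard X b {Y} m Y≤L = begin
      X + B + Y + M                       ≤⟨ +-monoˡ-≤ M (+-monoʳ-≤ (X + B) Y≤L) ⟩
      X + B + L + M                       ≡⟨ solve 4 (λ x b l m → x :+ b :+ l :+ m :* l := x :+ b :+ con 0ℚ :+ (con 1ℚ :+ m) :* l)
                                                     refl X B L (fromℕ m) ⟩
      X + B + 0ℚ + (1ℚ + fromℕ m) * L     ≡⟨ cong (λ y → X + B + 0ℚ + y * L) (fromℕ-suc m) ⟨
      budget X b 0ℚ (suc m)               ∎
      where
      open ≤-Reasoning
      B = fromℕ b * (L + μ)
      M = fromℕ m * L

    budget-close : ∀ X b {Y} m → Y ≤ L + μ → budget X b Y m ≤ budget X (suc b) 0ℚ m
    budget-close X b {Y} m Y≤L+μ = begin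
      X + fromℕ b * (L + μ) + Y + M              ≤⟨ +-monoˡ-≤ M (+-monoʳ-≤ (X + fromℕ b * (L + μ)) Y≤L+μ) ⟩
      X + fromℕ b * (L + μ) + (L + μ) + M        ≡⟨ solve 4 (λ x b c m → x :+ b :* c :+ c :+ m := x :+ (con 1ℚ :+ b) :* c :+ con 0ℚ :+ m)
                                                            refl X (fromℕ b) (L + μ) M ⟩
      X + (1ℚ + fromℕ b) * (L + μ) + 0ℚ + M      ≡⟨ cong (λ y → X + y * (L + μ) + 0ℚ + M) (fromℕ-suc b) ⟨
      budget X (suc b) 0ℚ m                      ∎
      where
      open ≤-Reasoning
      M = fromℕ m * L

    budget-shift : ∀ X x b Y m → budget (X + x) b Y m ≡ budget X b (Y + x) m
    budget-shift X x b Y m = solve 5 (λ X x B Y M → X :+ x :+ B :+ Y :+ M := X :+ B :+ (Y :+ x) :+ M)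
                                     refl X x (fromℕ b * (L + μ)) Y (fromℕ m * L)

    budget-final : ∀ b {Y} m → Y ≤ L → budget 0ℚ b Y m ≤ fromℕ b * (L + μ) + (fromℕ m + 1ℚ) * L
    budget-final b {Y} m Y≤L = begin
      0ℚ + B + Y + fromℕ m * L    ≤⟨ +-monoˡ-≤ (fromℕ m * L) (+-monoʳ-≤ (0ℚ + B) Y≤L) ⟩
      0ℚ + B + L + fromℕ m * L    ≡⟨ solve 3 (λ b l m → con 0ℚ :+ b :+ l :+ m :* l := b :+ (m :+ con 1ℚ) :* l) refl B L (fromℕ m) ⟩
      B + (fromℕ m + 1ℚ) * L      ∎
      where
      open ≤-Reasoning
      B = fromℕ b * (L + μ)

    record Packing (m : ℕ) (cap : ℚ) : Set where
      field
        slot               : Fin n → Slot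
        current            : ℕ
        bins≤current       : ∀ v {j} → slot v ≡ bin j → j ℕ.≤ current
        closed-balanced    : ∀ {j} → j ℕ.< current → L ≤ loadˢ slot (bin j) × loadˢ slot (bin j) ≤ L + μ
        current≤cap        : loadˢ slot (bin current) ≤ cap
        bins-monochromatic : ∀ u v {j} → slot u ≡ bin j → slot v ≡ bin j → d u ≡ d v
        accounted          : sum w ≤ budget (loadˢ slot unseen) current (loadˢ slot (bin current)) m

    open Packing

    Seen : ∀ {m cap} → Packing m cap → Fin n → Set
    Seen P v = slot P v ≢ unseen

    _⊑ˢ_ : ∀ {m m′ cap cap′} → Packing m cap → Packing m′ cap′ → Set
    P ⊑ˢ P′ = ∀ v → Seen P v → Seen P′ v

    CurrentIn : ∀ {m cap} → Fin χ → Packing m cap → Set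
    CurrentIn c P = ∀ u → slot P u ≡ bin (current P) → d u ≡ c

    beyond-current-empty : ∀ {m cap} (P : Packing m cap) {j} → current P ℕ.< j → loadˢ (slot P) (bin j) ≡ 0ℚ
    beyond-current-empty P current<j = load-absent (slot P) (bin _) λ v e → ℕ.<⇒≱ current<j (bins≤current P v e)

    empty : Packing 0 L
    empty = record
      { slot               = const unseen
      ; current            = 0
      ; bins≤current       = λ _ ()
      ; closed-balanced    = λ ()
      ; current≤cap        = subst (_≤ L) (sym bin-0-empty) 0≤L
      ; bins-monochromatic = λ _ _ ()
      ; accounted          = ≤-reflexive (begin
          sum w                          ≡⟨ wtWhere-all w (λ _ → refl) ⟨
          X                              ≡⟨ solve 3 (λ x b l → x := x :+ con 0ℚ :* b :+ con 0ℚ :+ con 0ℚ :* l) refl X (L + μ) L ⟩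
          budget X 0 0ℚ 0                ≡⟨ cong (λ y → budget X 0 y 0) bin-0-empty ⟨
          budget X 0 (loadˢ (const unseen) (bin 0)) 0 ∎)
      }
      where
      open ≡-Reasoning
      X = loadˢ (const unseen) unseen
      bin-0-empty : loadˢ (const unseen) (bin 0) ≡ 0ℚ
      bin-0-empty = load-absent (const unseen) (bin 0) λ _ ()

    discard : ∀ {m} → Packing m L → Packing (suc m) L
    discard {m} P = record
      { slot               = slot′
      ; current            = b
      ; bins≤current       = λ v e → bins≤current P v (discardBin-reflects b _ (λ ()) e)
      ; closed-balanced    = λ j<b → subst (λ x → L ≤ x × x ≤ L + μ) (sym (unchanged (λ ()) (ℕ.<⇒≢ j<b ∘ bin-injective)))
                                           (closed-balanced P j<b)
      ; current≤cap        = subst (_≤ L) (sym current-empty) 0≤L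
      ; bins-monochromatic = λ u v eu ev → bins-monochromatic P u v (discardBin-reflects b _ (λ ()) eu)
                                                                    (discardBin-reflects b _ (λ ()) ev)
      ; accounted          = begin
          sum w                                                        ≤⟨ accounted P ⟩
          budget (loadˢ (slot P) unseen) b (loadˢ (slot P) (bin b)) m  ≤⟨ budget-discard (loadˢ (slot P) unseen) b m (current≤cap P) ⟩
          budget (loadˢ (slot P) unseen) b 0ℚ (suc m)                  ≡⟨ cong₂ (λ x y → budget x b y (suc m))
                                                                                (unchanged (λ ()) (λ ())) current-empty ⟨
          budget (loadˢ slot′ unseen) b (loadˢ slot′ (bin b)) (suc m)  ∎
      }
      where
      open ≤-Reasoning
      b = current P
      slot′ : Fin n → Slot
      slot′ = discardBin b ∘ slot P
      unchanged : ∀ {t} → t ≢ discarded → t ≢ bin b → loadˢ slot′ t ≡ loadˢ (slot P) t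
      unchanged {t} t≢discarded t≢bin = wtWhere-cong w λ v → does-⇔
        (mk⇔ (discardBin-reflects b (slot P v) t≢discarded) (discardBin-preserves b (slot P v) t≢bin))
        (slot′ v ≟ˢ t) (slot P v ≟ˢ t)
      current-empty : loadˢ slot′ (bin b) ≡ 0ℚ
      current-empty = load-absent slot′ (bin b) (λ v → discardBin-removes b (slot P v))

    discard-⊑ : ∀ {m} (P : Packing m L) → P ⊑ˢ discard P
    discard-⊑ P v seen = seen ∘ discardBin-reflects (current P) (slot P v) (λ ())

    discard-current : ∀ {m} (P : Packing m L) c → CurrentIn c (discard P)
    discard-current P c u e = contradiction e (discardBin-removes (current P) (slot P u))

    module _ {m} (P : Packing m L) {v} (unseen-v : slot P v ≡ unseen) (current-dv : CurrentIn (d v) P) where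

      private
        b = current P
        slot′ = slot P [ v ≔ bin b ]

        not-in : ∀ {a} → a ≢ unseen → slot P v ≢ a
        not-in a≢unseen e = a≢unseen (trans (sym e) unseen-v)

        elsewhere : ∀ {u} → u ≢ v → slot′ u ≡ slot P u
        elsewhere = relabel-elsewhere (slot P) (bin b)

        grown : loadˢ slot′ (bin b) ≡ loadˢ (slot P) (bin b) + w v
        grown = load-relabel-to (slot P) v (not-in λ ())

        unseen-shrunk : loadˢ (slot P) unseen ≡ loadˢ slot′ unseen + w v
        unseen-shrunk = load-relabel-from (slot P) v unseen-v λ ()

        bins≤current′ : ∀ u {j} → slot′ u ≡ bin j → j ℕ.≤ b
        bins≤current′ u e with u Fin.≟ v
        ... | yes refl = ℕ.≤-reflexive (bin-injective (trans (sym e) (relabel-at (slot P) v (bin b))))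
        ... | no  u≢v  = bins≤current P u (trans (sym (elsewhere u≢v)) e)

        monochromatic′ : ∀ u₁ u₂ {j} → slot′ u₁ ≡ bin j → slot′ u₂ ≡ bin j → d u₁ ≡ d u₂
        monochromatic′ u₁ u₂ e₁ e₂ with u₁ Fin.≟ v | u₂ Fin.≟ v
        ... | yes refl | yes refl = refl
        ... | yes refl | no u₂≢v  = sym (current-dv u₂ (relabel-agree (slot P) (bin b) u₂≢v e₂ e₁))
        ... | no u₁≢v  | yes refl = current-dv u₁ (relabel-agree (slot P) (bin b) u₁≢v e₁ e₂)
        ... | no u₁≢v  | no u₂≢v  = bins-monochromatic P u₁ u₂ (trans (sym (elsewhere u₁≢v)) e₁)
                                                               (trans (sym (elsewhere u₂≢v)) e₂)

      add : Packing m (L + μ)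
      add = record
        { slot               = slot′
        ; current            = b
        ; bins≤current       = bins≤current′
        ; closed-balanced    = λ j<b → subst (λ x → L ≤ x × x ≤ L + μ)
            (sym (load-relabel-other (slot P) v (not-in λ ()) (ℕ.<⇒≢ j<b ∘ bin-injective ∘ sym)))
            (closed-balanced P j<b)
        ; current≤cap        = subst (_≤ L + μ) (sym grown) (+-mono-≤ (current≤cap P) (w≤μ v))
        ; bins-monochromatic = monochromatic′
        ; accounted          = begin
            sum w                                                        ≤⟨ accounted P ⟩
            budget (loadˢ (slot P) unseen) b (loadˢ (slot P) (bin b)) m  ≡⟨ cong (λ x → budget x b (loadˢ (slot P) (bin b)) m) unseen-shrunk ⟩
            budget (loadˢ slot′ unseen + w v) b (loadˢ (slot P) (bin b)) m ≡⟨ budget-shift (loadˢ slot′ unseen) (w v) b (loadˢ (slot P) (bin b)) m ⟩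
            budget (loadˢ slot′ unseen) b (loadˢ (slot P) (bin b) + w v) m ≡⟨ cong (λ y → budget (loadˢ slot′ unseen) b y m) grown ⟨
            budget (loadˢ slot′ unseen) b (loadˢ slot′ (bin b)) m        ∎
        }
        where open ≤-Reasoning

      add-⊑ : P ⊑ˢ add
      add-⊑ u seen with u Fin.≟ v
      ... | yes refl = contradiction unseen-v seen
      ... | no  u≢v  = seen ∘ trans (sym (elsewhere u≢v))

      add-seen : Seen add v
      add-seen e = contradiction (trans (sym (relabel-at (slot P) v (bin b))) e) λ ()

      add-current : CurrentIn (d v) add
      add-current u e with u Fin.≟ v
      ... | yes refl = refl
      ... | no  u≢v  = current-dv u (trans (sym (elsewhere u≢v)) e)

    close : ∀ {m} (P : Packing m (L + μ)) → L ≤ loadˢ (slot P) (bin (current P)) → Packing m L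
    close {m} P full = record
      { slot               = slot P
      ; current            = suc b
      ; bins≤current       = λ v e → ℕ.m≤n⇒m≤1+n (bins≤current P v e)
      ; closed-balanced    = closed-balanced′
      ; current≤cap        = subst (_≤ L) (sym next-empty) 0≤L
      ; bins-monochromatic = bins-monochromatic P
      ; accounted          = begin
          sum w                                                              ≤⟨ accounted P ⟩
          budget (loadˢ (slot P) unseen) b (loadˢ (slot P) (bin b)) m        ≤⟨ budget-close (loadˢ (slot P) unseen) b m (current≤cap P) ⟩
          budget (loadˢ (slot P) unseen) (suc b) 0ℚ m                        ≡⟨ cong (λ y → budget (loadˢ (slot P) unseen) (suc b) y m) next-empty ⟨
          budget (loadˢ (slot P) unseen) (suc b) (loadˢ (slot P) (bin (suc b))) m ∎
      }
      where
      open ≤-Reasoning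
      b = current P
      next-empty : loadˢ (slot P) (bin (suc b)) ≡ 0ℚ
      next-empty = beyond-current-empty P (ℕ.n<1+n b)
      closed-balanced′ : ∀ {j} → j ℕ.< suc b → L ≤ loadˢ (slot P) (bin j) × loadˢ (slot P) (bin j) ≤ L + μ
      closed-balanced′ j<1+b with ℕ.m<1+n⇒m<n∨m≡n j<1+b
      ... | inj₁ j<b  = closed-balanced P j<b
      ... | inj₂ refl = full , current≤cap P

    keep : ∀ {m} (P : Packing m (L + μ)) → loadˢ (slot P) (bin (current P)) < L → Packing m L
    keep P light = record
      { slot               = slot P
      ; current            = current P
      ; bins≤current       = bins≤current P
      ; closed-balanced    = closed-balanced P
      ; current≤cap        = <⇒≤ light
      ; bins-monochromatic = bins-monochromatic P
      ; accounted          = accounted P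
      }

    place : ∀ {m} c (P : Packing m L) → CurrentIn c P → ∀ v →
            Σ (Packing m L) λ P′ → P ⊑ˢ P′ × CurrentIn c P′ × (d v ≡ c → Seen P′ v)
    place c P current-c v with d v Fin.≟ c | slot P v in slot-v
    ... | no dv≢c  | _      = P , (λ _ s → s) , current-c , λ dv≡c → contradiction dv≡c dv≢c
    ... | yes _    | just _ = P , (λ _ s → s) , current-c , λ _ e → contradiction (trans (sym slot-v) e) λ ()
    ... | yes refl | unseen with L ≤? loadˢ (slot (add P slot-v current-c)) (bin (current P))
    ...   | yes full   = close P₊ full , add-⊑ P slot-v current-c
                       , (λ u e → contradiction (bins≤current P₊ u e) (ℕ.<-irrefl refl))
                       , λ _ → add-seen P slot-v current-c
      where P₊ = add P slot-v current-c
    ...   | no  unfull = keep P₊ (≰⇒> unfull) , add-⊑ P slot-v current-c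
                       , add-current P slot-v current-c
                       , λ _ → add-seen P slot-v current-c
      where P₊ = add P slot-v current-c

    pack-colour : ∀ {m} c (vs : List (Fin n)) (P : Packing m L) → CurrentIn c P →
                  Σ (Packing m L) λ P′ → P ⊑ˢ P′ × All (λ v → d v ≡ c → Seen P′ v) vs
    pack-colour c []       P _ = P , (λ _ s → s) , []
    pack-colour c (v ∷ vs) P current-c with place c P current-c v
    ... | P₁ , P⊑P₁ , current-c₁ , seen-v with pack-colour c vs P₁ current-c₁
    ...   | P₂ , P₁⊑P₂ , seen-vs = P₂ , (λ u → P₁⊑P₂ u ∘ P⊑P₁ u) , (P₁⊑P₂ v ∘ seen-v) ∷ seen-vs

    pack-all : (cs : List (Fin χ)) → Σ (Packing (length cs) L) λ P → ∀ v → d v ∈ cs → Seen P v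
    pack-all []       = empty , λ _ ()
    pack-all (c ∷ cs) with pack-all cs
    ... | P , seen with pack-colour c (allFin n) (discard P) (discard-current P c)
    ...   | P′ , discard⊑P′ , covered = P′ , λ where
      v (here dv≡c)   → All.lookup covered (∈-allFin v) dv≡c
      v (there dv∈cs) → discard⊑P′ v (discard-⊑ P v (seen v dv∈cs))

    private
      P = proj₁ (pack-all (allFin χ))
      b = current P

    total-weight : sum w ≤ fromℕ b * (L + μ) + (fromℕ χ + 1ℚ) * L
    total-weight = begin
      sum w                                                                         ≤⟨ accounted P ⟩
      budget (loadˢ (slot P) unseen) b (loadˢ (slot P) (bin b)) (length (allFin χ)) ≡⟨ cong₂ (λ x m → budget x b (loadˢ (slot P) (bin b)) m)
                                                                                              nothing-unseen (length-tabulate {A = Fin χ} id) ⟩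
      budget 0ℚ b (loadˢ (slot P) (bin b)) χ                                        ≤⟨ budget-final b χ (current≤cap P) ⟩
      fromℕ b * (L + μ) + (fromℕ χ + 1ℚ) * L                                        ∎
      where
      open ≤-Reasoning
      nothing-unseen : loadˢ (slot P) unseen ≡ 0ℚ
      nothing-unseen = load-absent (slot P) unseen λ v → proj₂ (pack-all (allFin χ)) v (∈-allFin (d v))

    load-from-current≤L : ∀ {j} → b ℕ.≤ j → loadˢ (slot P) (bin j) ≤ L
    load-from-current≤L {j} b≤j with b ℕ.≟ j
    ... | yes refl = current≤cap P
    ... | no  b≢j  = subst (_≤ L) (sym (beyond-current-empty P (ℕ.≤∧≢⇒< b≤j b≢j))) 0≤L

    -- If fewer than k bins are closed, then L = 0 and every bin is trivially balanced.
    bin-balanced : ∀ {j} → j ℕ.< k → L ≤ loadˢ (slot P) (bin j) × loadˢ (slot P) (bin j) ≤ L + μ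
    bin-balanced {j} j<k with j ℕ.<? b
    ... | yes j<b = closed-balanced P j<b
    ... | no  j≮b = ≤-trans (few-bins⇒L≤0 b (ℕ.≤-<-trans b≤j j<k) total-weight) (load-nonNeg 0≤w (slot P) (bin j))
                  , ≤-trans (load-from-current≤L b≤j) (p≤p+q 0≤μ)
      where b≤j = ℕ.≮⇒≥ j≮b

    classWeight-toColour : ∀ i → classWeight (toColour ∘ slot P) i ≡ loadˢ (slot P) (bin (toℕ i))
    classWeight-toColour i = wtWhere-cong w λ v →
      does-⇔ (toColour-≡ (slot P v) i) (toColour (slot P v) ≟ᶜ just i) (slot P v ≟ˢ bin (toℕ i))

    packed : Σ PartialColouring (Balanced L (L + μ))
    packed = toColour ∘ slot P , record
      { proper = λ u v a e₁ e₂ → d-proper u v a (bins-monochromatic P u v (in-bin e₁) (in-bin e₂))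
      ; lower  = λ i → subst (L ≤_) (sym (classWeight-toColour i)) (proj₁ (bin-balanced (Fin.toℕ<n i)))
      ; upper  = λ i → subst (_≤ L + μ) (sym (classWeight-toColour i)) (proj₂ (bin-balanced (Fin.toℕ<n i)))
      }
      where
      in-bin : ∀ {u i} → toColour (slot P u) ≡ just i → slot P u ≡ bin (toℕ i)
      in-bin {u} {i} = Equivalence.to (toColour-≡ (slot P u) i)

  module GreedyCompletion (Δ : ℕ) (deg≤Δ : ∀ v → degree G v ℕ.≤ Δ) (Δ<k : Δ ℕ.< k)
    (L μ U : ℚ) (w≤μ : ∀ v → w v ≤ μ)
    (room : ∀ t → L ≤ t → (fromℕ k - fromℕ Δ) * t + fromℕ Δ * L ≤ sum w → t + μ ≤ U) where

    Coloured : PartialColouring → Fin n → Set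
    Coloured p v = ∃ λ j → p v ≡ just j

    _⊑_ : PartialColouring → PartialColouring → Set
    p ⊑ q = ∀ u {j} → p u ≡ just j → q u ≡ just j

    Blocked : PartialColouring → Fin n → Fin k → Set
    Blocked p v j = ∃ λ u → adj G v u ≡ true × p u ≡ just j

    blocked? : ∀ p v → Decidable (Blocked p v)
    blocked? p v j = Fin.any? (λ u → (adj G v u Bool.≟ true) ×-dec (p u ≟ᶜ just j))

    #blocked : PartialColouring → Fin n → ℚ
    #blocked p v = ∑[ j < k ] indicator (does (blocked? p v j))

    ∑-adjacent-class≤ : ∀ b x → ∑[ j < k ] indicator (b ∧ does (x ≟ᶜ just j)) ≤ indicator b
    ∑-adjacent-class≤ true  x = ∑-one-class≤ x (indicator-nonNeg true)
    ∑-adjacent-class≤ false x = ≤-reflexive (sum-replicate-zero k)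

    -- A blocked colour is witnessed by a neighbour, and each neighbour witnesses at most one colour.
    #blocked≤Δ : ∀ p v → #blocked p v ≤ fromℕ Δ
    #blocked≤Δ p v = begin
      #blocked p v                                         ≤⟨ sum-mono blocked≤witnesses ⟩
      ∑[ j < k ] ∑[ u < n ] indicator (witness j u)        ≡⟨ ∑-comm (λ j u → indicator (witness j u)) ⟩
      ∑[ u < n ] ∑[ j < k ] indicator (witness j u)        ≤⟨ sum-mono (λ u → ∑-adjacent-class≤ (adj G v u) (p u)) ⟩
      ∑[ u < n ] indicator (adj G v u)                     ≡⟨ fromℕ-∣tabulate∣ (adj G v) ⟨
      fromℕ (degree G v)                                   ≤⟨ fromℕ-mono-≤ (deg≤Δ v) ⟩
      fromℕ Δ                                              ∎
      where
      open ≤-Reasoning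
      witness : Fin k → Fin n → Bool
      witness j u = adj G v u ∧ does (p u ≟ᶜ just j)
      blocked≤witnesses : ∀ j → indicator (does (blocked? p v j)) ≤ ∑[ u < n ] indicator (witness j u)
      blocked≤witnesses j with blocked? p v j
      ... | no  _             = sum-nonNeg (λ u → indicator-nonNeg (witness j u))
      ... | yes (u , vu , pu) = subst (_≤ _) witness≡1 (f≤sum (λ u → indicator-nonNeg (witness j u)) u)
        where
        witness≡1 : indicator (witness j u) ≡ 1ℚ
        witness≡1 rewrite vu | dec-true (p u ≟ᶜ just j) pu = refl

    Free : PartialColouring → Fin n → Fin k → Set
    Free p v j = ¬ Blocked p v j

    IsLightestFree : PartialColouring → Fin n → Fin k → Set
    IsLightestFree p v j = Free p v j × (∀ j′ → Free p v j′ → classWeight p j ≤ classWeight p j′)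

    lightest-free : ∀ p v → ∃ (IsLightestFree p v)
    lightest-free p v with argmin? (¬? ∘ blocked? p v) (classWeight p)
    ... | inj₂ lightest  = lightest
    ... | inj₁ none-free = contradiction (fromℕ-cancel-≤ k≤Δ) (ℕ.<⇒≱ Δ<k)
      where
      all-blocked : ∀ j → indicator (does (blocked? p v j)) ≡ 1ℚ
      all-blocked j = cong indicator (dec-true (blocked? p v j) (decidable-stable (blocked? p v j) (none-free j)))
      k≤Δ : fromℕ k ≤ fromℕ Δ
      k≤Δ = begin
        fromℕ k        ≡⟨ *-identityʳ (fromℕ k) ⟨
        fromℕ k * 1ℚ   ≡⟨ sum-const k 1ℚ ⟨
        ∑[ j < k ] 1ℚ  ≡⟨ sum-cong-≗ all-blocked ⟨
        #blocked p v   ≤⟨ #blocked≤Δ p v ⟩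
        fromℕ Δ        ∎
        where open ≤-Reasoning

    -- Blocked classes weigh at least L, free ones at least the lightest free one, and at most Δ are blocked.
    lightest-free-bound : ∀ {p v j} → (∀ j → L ≤ classWeight p j) → IsLightestFree p v j →
                          (fromℕ k - fromℕ Δ) * classWeight p j + fromℕ Δ * L ≤ sum w
    lightest-free-bound {p} {v} {j} lower (_ , lightest) = begin
      (K - D) * t + D * L                           ≤⟨ 0≤q-p⇒p≤q (subst (0ℚ ≤_) gap 0≤[t-L][D-N]) ⟩
      K * t + (L - t) * N                           ≡⟨ ∑-estimate ⟨
      ∑[ j′ < k ] (t + (L - t) * isBlocked j′)        ≤⟨ sum-mono estimate≤ ⟩
      ∑[ j′ < k ] classWeight p j′                  ≤⟨ ∑-classWeight≤total p ⟩
      sum w                                         ∎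
      where
      open ≤-Reasoning
      K = fromℕ k
      D = fromℕ Δ
      t = classWeight p j
      N = #blocked p v
      isBlocked : Fin k → ℚ
      isBlocked j′ = indicator (does (blocked? p v j′))
      estimate≤ : ∀ j′ → t + (L - t) * indicator (does (blocked? p v j′)) ≤ classWeight p j′
      estimate≤ j′ with blocked? p v j′
      ... | yes _ = subst (_≤ _) (solve 2 (λ t l → l := t :+ (l :- t) :* con 1ℚ) refl t L) (lower j′)
      ... | no ¬b = subst (_≤ _) (solve 2 (λ t l → t := t :+ (l :- t) :* con 0ℚ) refl t L) (lightest j′ ¬b)
      ∑-estimate : ∑[ j′ < k ] (t + (L - t) * isBlocked j′) ≡ K * t + (L - t) * N
      ∑-estimate = trans (∑-distrib-+ (const t) (λ j′ → (L - t) * isBlocked j′))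
                         (cong₂ _+_ (sum-const k t) (sym (*-distribˡ-sum (L - t) isBlocked)))
      0≤[t-L][D-N] : 0ℚ ≤ (t - L) * (D - N)
      0≤[t-L][D-N] = *-nonNeg (p≤q⇒0≤q-p (lower j)) (p≤q⇒0≤q-p (#blocked≤Δ p v))
      gap : (t - L) * (D - N) ≡ (K * t + (L - t) * N) - ((K - D) * t + D * L)
      gap = solve 5 (λ t l d nb kk → (t :- l) :* (d :- nb) := (kk :* t :+ (l :- t) :* nb) :- ((kk :- d) :* t :+ d :* l))
                    refl t L D N K

    assign-proper : ∀ {p v j} → IsProperPartial p → Free p v j → IsProperPartial (p [ v ≔ just j ])
    assign-proper {p} {v} {j} proper free u₁ u₂ a e₁ e₂ with u₁ Fin.≟ v | u₂ Fin.≟ v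
    ... | yes refl | yes refl = contradiction (trans (sym a) (irrefl G u₁)) λ ()
    ... | yes refl | no u₂≢v  = free (u₂ , a , relabel-agree p (just j) u₂≢v e₂ e₁)
    ... | no u₁≢v  | yes refl = free (u₁ , trans (symm G v u₁) a , relabel-agree p (just j) u₁≢v e₁ e₂)
    ... | no u₁≢v  | no u₂≢v  = proper u₁ u₂ a (trans (sym (relabel-elsewhere p _ u₁≢v)) e₁)
                                                 (trans (sym (relabel-elsewhere p _ u₂≢v)) e₂)

    assign-balanced : ∀ {p v j} → Balanced L U p → p v ≡ nothing → Free p v j → classWeight p j + μ ≤ U →
                      Balanced L U (p [ v ≔ just j ])
    assign-balanced {p} {v} {j} bal pv free fits = record
      { proper = assign-proper proper free ; lower = lower′ ; upper = upper′ }
      where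
      open Balanced bal
      uncoloured : ∀ {i} → p v ≢ just i
      uncoloured = (λ ()) ∘ trans (sym pv)
      weight-j : classWeight (p [ v ≔ just j ]) j ≡ classWeight p j + w v
      weight-j = loadᶜ-relabel-to p v uncoloured
      weight-other : ∀ {j′} → j′ ≢ j → classWeight (p [ v ≔ just j ]) j′ ≡ classWeight p j′
      weight-other j′≢j = loadᶜ-relabel-other p v uncoloured (j′≢j ∘ sym ∘ just-injective)
      lower′ : ∀ j′ → L ≤ classWeight (p [ v ≔ just j ]) j′
      lower′ j′ with j′ Fin.≟ j
      ... | yes refl = subst (L ≤_) (sym weight-j) (≤-trans (lower j) (p≤p+q (0≤w v)))
      ... | no j′≢j  = subst (L ≤_) (sym (weight-other j′≢j)) (lower j′)
      upper′ : ∀ j′ → classWeight (p [ v ≔ just j ]) j′ ≤ U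
      upper′ j′ with j′ Fin.≟ j
      ... | yes refl = subst (_≤ U) (sym weight-j) (≤-trans (+-monoʳ-≤ (classWeight p j) (w≤μ v)) fits)
      ... | no j′≢j  = subst (_≤ U) (sym (weight-other j′≢j)) (upper j′)

    colour-vertex : ∀ {p} → Balanced L U p → ∀ v → ∃ λ q → Balanced L U q × p ⊑ q × Coloured q v
    colour-vertex {p} bal v with p v in pv
    ... | just i  = p , bal , (λ _ e → e) , (i , pv)
    ... | nothing with lightest-free p v
    ...   | j , lightest =
      p [ v ≔ just j ] , assign-balanced bal pv (proj₁ lightest) fits , extends , (j , relabel-at p v (just j))
      where
      open Balanced bal
      fits : classWeight p j + μ ≤ U
      fits = room (classWeight p j) (lower j) (lightest-free-bound lower lightest)
      extends : p ⊑ (p [ v ≔ just j ])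
      extends u e with u Fin.≟ v
      ... | yes refl = contradiction (trans (sym pv) e) λ ()
      ... | no u≢v   = trans (relabel-elsewhere p _ u≢v) e

    colour-all : ∀ {p} → Balanced L U p → (vs : List (Fin n)) → ∃ λ q → Balanced L U q × All (Coloured q) vs
    colour-all bal []       = _ , bal , []
    colour-all bal (v ∷ vs) with colour-all bal vs
    ... | q , bal-q , coloured-vs with colour-vertex bal-q v
    ...   | r , bal-r , q⊑r , coloured-v = r , bal-r , coloured-v ∷ All.map (λ (j , e) → j , q⊑r _ e) coloured-vs

    complete : ∀ {p} → Balanced L U p → Σ (Fin n → Fin k) (λ c → Balanced L U (just ∘ c))
    complete bal with colour-all bal (allFin n)
    ... | q , bal-q , coloured = proj₁ ∘ colour-of , Balanced-cong (proj₂ ∘ colour-of) bal-q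
      where
      colour-of : ∀ v → Coloured q v
      colour-of v = All.lookup coloured (∈-allFin v)

f≤foldr-⊔ : ∀ {A : Set} (f : A → ℕ) {x xs} → x ∈ xs → f x ℕ.≤ foldr ℕ._⊔_ 0 (map f xs)
f≤foldr-⊔ f (here refl)             = ℕ.m≤m⊔n _ _
f≤foldr-⊔ f {xs = y ∷ _} (there x∈) = ℕ.≤-trans (f≤foldr-⊔ f x∈) (ℕ.m≤n⊔m (f y) _)

degree≤maxDegree : ∀ {n} (G : Graph n) v → degree G v ℕ.≤ maxDegree G
degree≤maxDegree G v = f≤foldr-⊔ (degree G) (∈-allFin v)

m<n⇐2m≤n : ∀ {m n} → 1 ℕ.≤ n → 2 ℕ.* m ℕ.≤ n → m ℕ.< n
m<n⇐2m≤n {zero}  1≤n _    = 1≤n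
m<n⇐2m≤n {suc m} _   2m≤n = ℕ.<-≤-trans (ℕ.m<m+n (suc m) ℕ.z<s) 2m≤n

0<fromℕ : ∀ {k} → 1 ℕ.≤ k → 0ℚ < fromℕ k
0<fromℕ 1≤k = <-≤-trans (positive⁻¹ 1ℚ) (fromℕ-mono-≤ 1≤k)

module Thresholds (ε : ℚ) (0<ε : 0ℚ < ε) (ε≤1/10 : ε ≤ + 1 / 10)
                  (k : ℕ) (1≤k : 1 ℕ.≤ k) (W : ℚ) (0≤W : 0ℚ ≤ W) where

  private
    K = fromℕ k
    0<K = 0<fromℕ 1≤k
    instance
      K>0 : Positive K
      K>0 = positive 0<K
      K≢0 : NonZero K
      K≢0 = pos⇒nonZero K
      1/K>0 : Positive (1/ K)
      1/K>0 = 1/pos⇒pos K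

  a : ℚ
  a = 1/ K * W

  0≤a : 0ℚ ≤ a
  0≤a = *-nonNeg (<⇒≤ (positive⁻¹ (1/ K))) 0≤W

  k*a≡W : K * a ≡ W
  k*a≡W = begin
    K * (1/ K * W)  ≡⟨ *-assoc K (1/ K) W ⟨
    K * 1/ K * W    ≡⟨ cong (_* W) (*-inverseʳ K) ⟩
    1ℚ * W          ≡⟨ *-identityˡ W ⟩
    W               ∎
    where open ≡-Reasoning

  L μ U : ℚ
  L = (1ℚ - fromℕ 2 * ε) * a
  μ = ε * a
  U = (1ℚ + fromℕ 3 * ε) * a

  0≤ε : 0ℚ ≤ ε
  0≤ε = <⇒≤ 0<ε

  0≤1+7ε : 0ℚ ≤ 1ℚ + fromℕ 7 * ε
  0≤1+7ε = +-nonNeg (<⇒≤ (positive⁻¹ 1ℚ)) (*-nonNeg (fromℕ-nonNeg 7) 0≤ε)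

  0≤1-c*ε : ∀ c → 0ℚ ≤ c → c * (+ 1 / 10) ≤ 1ℚ → 0ℚ ≤ 1ℚ - c * ε
  0≤1-c*ε c 0≤c c/10≤1 = p≤q⇒0≤q-p (≤-trans (*-monoˡ-≤-nonNeg′ 0≤c ε≤1/10) c/10≤1)

  0≤1-2ε : 0ℚ ≤ 1ℚ - fromℕ 2 * ε
  0≤1-2ε = 0≤1-c*ε (fromℕ 2) (fromℕ-nonNeg 2) (≤ᵇ⇒≤ _)

  0≤L : 0ℚ ≤ L
  0≤L = *-nonNeg 0≤1-2ε 0≤a

  0≤μ : 0ℚ ≤ μ
  0≤μ = *-nonNeg 0≤ε 0≤a

  L+μ≤U : L + μ ≤ U
  L+μ≤U = 0≤q-p⇒p≤q (subst (0ℚ ≤_) gap (*-nonNeg (fromℕ-nonNeg 4) 0≤μ))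
    where
    gap : fromℕ 4 * (ε * a) ≡ U - (L + μ)
    gap = solve 2 (λ e a → con (fromℕ 4) :* (e :* a)
                         := (con 1ℚ :+ con (fromℕ 3) :* e) :* a
                            :- ((con 1ℚ :- con (fromℕ 2) :* e) :* a :+ e :* a))
                  refl ε a

  -- (1 + 7ε)(1 - 2ε) - (1 + 3ε) = 2ε(1 - 7ε), which needs ε ≤ 1/7.
  U≤[1+7ε]L : U ≤ (1ℚ + fromℕ 7 * ε) * L
  U≤[1+7ε]L = 0≤q-p⇒p≤q (subst (0ℚ ≤_) gap (*-nonNeg (*-nonNeg (fromℕ-nonNeg 2) 0≤ε) (*-nonNeg 0≤1-7ε 0≤a)))
    where
    0≤1-7ε = 0≤1-c*ε (fromℕ 7) (fromℕ-nonNeg 7) (≤ᵇ⇒≤ _)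
    gap : fromℕ 2 * ε * ((1ℚ - fromℕ 7 * ε) * a) ≡ (1ℚ + fromℕ 7 * ε) * L - U
    gap = solve 2 (λ e a → con (fromℕ 2) :* e :* ((con 1ℚ :- con (fromℕ 7) :* e) :* a)
                         := (con 1ℚ :+ con (fromℕ 7) :* e) :* ((con 1ℚ :- con (fromℕ 2) :* e) :* a)
                            :- (con 1ℚ :+ con (fromℕ 3) :* e) :* a)
                  refl ε a

  weight≤μ : ∀ x → x * K ≤ ε * W → x ≤ μ
  weight≤μ x x*k≤εW = *-cancelˡ-≤-pos′ 0<K (begin
    K * x        ≡⟨ *-comm K x ⟩
    x * K        ≤⟨ x*k≤εW ⟩
    ε * W        ≡⟨ cong (ε *_) k*a≡W ⟨
    ε * (K * a)  ≡⟨ solve 3 (λ e k a → e :* (k :* a) := k :* (e :* a)) refl ε K a ⟩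
    K * μ        ∎)
    where open ≤-Reasoning

  -- With b ≤ k - 1 and χ ≤ εk the bound reads ka ≤ ka - (ε + 2ε²k)a, forcing a = 0.
  few-bins⇒L≤0 : ∀ χ → fromℕ χ ≤ ε * K → ∀ b → b ℕ.< k →
                 W ≤ fromℕ b * (L + μ) + (fromℕ χ + 1ℚ) * L → L ≤ 0ℚ
  few-bins⇒L≤0 χ χ≤εk b b<k W≤ = ≤-trans (*-monoˡ-≤-nonNeg′ 0≤1-2ε a≤0) (≤-reflexive (*-zeroʳ (1ℚ - fromℕ 2 * ε)))
    where
    c = ε + fromℕ 2 * ε * ε * K
    b≤K-1 : fromℕ b ≤ K - 1ℚ
    b≤K-1 = subst (_≤ K - 1ℚ) (solve 1 (λ x → (con 1ℚ :+ x) :- con 1ℚ := x) refl (fromℕ b))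
              (+-monoˡ-≤ (- 1ℚ) (subst (_≤ K) (fromℕ-suc b) (fromℕ-mono-≤ b<k)))
    expand : (K - 1ℚ) * (L + μ) + (ε * K + 1ℚ) * L ≡ K * a - c * a
    expand = solve 3 (λ e a k → (k :- con 1ℚ) :* ((con 1ℚ :- con (fromℕ 2) :* e) :* a :+ e :* a)
                                :+ (e :* k :+ con 1ℚ) :* ((con 1ℚ :- con (fromℕ 2) :* e) :* a)
                              := k :* a :- (e :+ con (fromℕ 2) :* e :* e :* k) :* a)
                   refl ε a K
    Ka≤Ka-ca : K * a ≤ K * a - c * a
    Ka≤Ka-ca = begin
      K * a                                    ≡⟨ k*a≡W ⟩
      W                                        ≤⟨ W≤ ⟩
      fromℕ b * (L + μ) + (fromℕ χ + 1ℚ) * L    ≤⟨ +-mono-≤ (*-monoʳ-≤-nonNeg′ (+-nonNeg 0≤L 0≤μ) b≤K-1)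
                                                            (*-monoʳ-≤-nonNeg′ 0≤L (+-monoˡ-≤ 1ℚ χ≤εk)) ⟩
      (K - 1ℚ) * (L + μ) + (ε * K + 1ℚ) * L    ≡⟨ expand ⟩
      K * a - c * a                            ∎
      where open ≤-Reasoning
    ca≤0 : c * a ≤ 0ℚ
    ca≤0 = 0≤q-p⇒p≤q (subst (0ℚ ≤_) (solve 2 (λ x y → (x :- y) :- x := con 0ℚ :- y) refl (K * a) (c * a))
                                    (p≤q⇒0≤q-p Ka≤Ka-ca))
    0<c : 0ℚ < c
    0<c = <-≤-trans 0<ε (p≤p+q (*-nonNeg (*-nonNeg (*-nonNeg (fromℕ-nonNeg 2) 0≤ε) 0≤ε) (fromℕ-nonNeg k)))
    a≤0 : a ≤ 0ℚ
    a≤0 = *-cancelˡ-≤-pos′ 0<c (subst (c * a ≤_) (sym (*-zeroʳ c)) ca≤0)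

  -- With s = t - L: ks ≤ 2(k - Δ)s ≤ 2k(a - L), so t ≤ L + 4εa and t + μ ≤ (1 + 3ε)a.
  lightest-fits : ∀ Δ → 2 ℕ.* Δ ℕ.≤ k → ∀ t → L ≤ t → (K - fromℕ Δ) * t + fromℕ Δ * L ≤ W → t + μ ≤ U
  lightest-fits Δ 2Δ≤k t L≤t bound = begin
    t + μ                      ≡⟨ solve 3 (λ t l m → t :+ m := l :+ (t :- l) :+ m) refl t L μ ⟩
    L + s + μ                  ≤⟨ +-monoˡ-≤ μ (+-monoʳ-≤ L s≤2[a-L]) ⟩
    L + fromℕ 2 * (a - L) + μ  ≡⟨ collect ⟩
    U                          ∎
    where
    open ≤-Reasoning
    D = fromℕ Δ
    s = t - L
    collect : L + fromℕ 2 * (a - L) + μ ≡ U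
    collect = solve 2 (λ e a → (con 1ℚ :- con (fromℕ 2) :* e) :* a
                               :+ con (fromℕ 2) :* (a :- (con 1ℚ :- con (fromℕ 2) :* e) :* a) :+ e :* a
                             := (con 1ℚ :+ con (fromℕ 3) :* e) :* a)
                    refl ε a
    D+D≤K : D + D ≤ K
    D+D≤K = subst (_≤ K) (trans (fromℕ-+ Δ (Δ ℕ.+ 0)) (cong (λ m → D + fromℕ m) (ℕ.+-identityʳ Δ)))
                  (fromℕ-mono-≤ 2Δ≤k)
    [K-D]s≤W-KL : (K - D) * s ≤ W - K * L
    [K-D]s≤W-KL = subst (_≤ W - K * L)
      (solve 4 (λ k d t l → (k :- d) :* t :+ d :* l :- k :* l := (k :- d) :* (t :- l)) refl K D t L)
      (+-monoˡ-≤ (- (K * L)) bound)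
    Ks≤2[K-D]s : K * s ≤ fromℕ 2 * ((K - D) * s)
    Ks≤2[K-D]s = 0≤q-p⇒p≤q (subst (0ℚ ≤_)
      (solve 3 (λ k d s → (k :- (d :+ d)) :* s := con (fromℕ 2) :* ((k :- d) :* s) :- k :* s) refl K D s)
      (*-nonNeg (p≤q⇒0≤q-p D+D≤K) (p≤q⇒0≤q-p L≤t)))
    s≤2[a-L] : s ≤ fromℕ 2 * (a - L)
    s≤2[a-L] = *-cancelˡ-≤-pos′ 0<K (begin
      K * s                      ≤⟨ Ks≤2[K-D]s ⟩
      fromℕ 2 * ((K - D) * s)    ≤⟨ *-monoˡ-≤-nonNeg′ (fromℕ-nonNeg 2) [K-D]s≤W-KL ⟩
      fromℕ 2 * (W - K * L)      ≡⟨ cong (λ x → fromℕ 2 * (x - K * L)) k*a≡W ⟨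
      fromℕ 2 * (K * a - K * L)  ≡⟨ solve 3 (λ k a l → con (fromℕ 2) :* (k :* a :- k :* l) := k :* (con (fromℕ 2) :* (a :- l)))
                                            refl K a L ⟩
      K * (fromℕ 2 * (a - L))    ∎)

theorem6 : ∀ {n} (G : Graph n) (w : Fin n → ℚ) → (∀ v → 0ℚ ≤ w v) →
  (ε : ℚ) → 0ℚ < ε → ε ≤ + 1 / 10 →
  (k : ℕ) → 1 ℕ.≤ k →
  (χ : ℕ) → IsChromaticNumber G χ →
  (+ χ / 1) ≤ ε * (+ k / 1) → 2 ℕ.* maxDegree G ℕ.≤ k →
  (∀ v → w v * (+ k / 1) ≤ ε * wt w ⊤) →
  Σ (Fin n → Fin k) (λ c → IsProperColoring G k c × IsEQ1 w (1ℚ + (+ 7 / 1) * ε) c)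
theorem6 {n} G w 0≤w ε 0<ε ε≤1/10 k 1≤k χ ((d , d-proper) , _) χ≤εk 2Δ≤k w*k≤εW =
  c , proper-total (Balanced.proper balanced) , Balanced⇒IsEQ1 balanced 0≤1+7ε U≤[1+7ε]L
  where
  open Thresholds ε 0<ε ε≤1/10 k 1≤k (sum w) (sum-nonNeg 0≤w)
  open PartialColourings G w 0≤w k
  w≤μ : ∀ v → w v ≤ μ
  w≤μ v = weight≤μ (w v) (subst (λ W → w v * fromℕ k ≤ ε * W) (wt-⊤ w) (w*k≤εW v))
  packed : Σ PartialColouring (Balanced L (L + μ))
  packed = BinPacking.packed d d-proper L μ 0≤L 0≤μ w≤μ (few-bins⇒L≤0 χ χ≤εk)
  completed : Σ (Fin n → Fin k) (λ c → Balanced L U (just ∘ c))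
  completed = GreedyCompletion.complete (maxDegree G) (degree≤maxDegree G) (m<n⇐2m≤n 1≤k 2Δ≤k) L μ U w≤μ
    (lightest-fits (maxDegree G) 2Δ≤k) (Balanced-weaken L+μ≤U (proj₂ packed))
  c : Fin n → Fin k
  c = proj₁ completed
  balanced : Balanced L U (just ∘ c)
  balanced = proj₂ completed
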